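{- Let $\Sigma$ be a subexponential signature where all labels $i$ have $f(i)\subseteq\{\mathsf{C},\mathsf{W},\mathsf{E}\}$, and let $\Gamma\Rightarrow A$ be an $\mathsf{acLL}_\Sigma$ sequent. If $\vdash(\widehat{\Gamma}^{\perp},\widehat{A})$ is provable in $\mathsf{CacLL}_\Sigma$, then $\Gamma\Rightarrow A$ is provable in $\mathsf{acLL}_\Sigma$.
   Context: $\mathsf{CacLL}_\Sigma$ is the one-sided classical non-associative non-commutative linear logic with subexponentials over a signature $\Sigma=(I,\preceq,f)$, $f:I\to 2^{\{\mathsf{C},\mathsf{W},\mathsf{A1},\mathsf{A2},\mathsf{E}\}}$ upward closed; sequents $\vdash\Gamma$ with binary-tree structures, connectives $\otimes$, par $⅋$, $\oplus$, with $\mathbin{\&}$, units, subexponentials, top-level exchange/associativity and $?$-licensed structural rules. $\mathsf{acLL}_\Sigma$ is the intuitionistic two-sided counterpart with sequents $\Gamma\Rightarrow A$ (structure antecedent, single succedent) and connectives $\mathbin{\&},\oplus,\otimes,\to,\leftarrow,\top,!^i,\mathsf{1}$. The translation: $\widehat{p}=p$, $\widehat{A\otimes B}=\widehat{A}\otimes\widehat{B}$, $\widehat{A\to B}=\widehat{A}^{\perp}⅋\widehat{B}$, $\widehat{B\leftarrow A}=\widehat{B}⅋\widehat{A}^{\perp}$, $\widehat{A\mathbin{\&}B}=\widehat{A}\mathbin{\&}\widehat{B}$, $\widehat{A\oplus B}=\widehat{A}\oplus\widehat{B}$, $\widehat{!^iA}=!^i\widehat{A}$, $\widehat{\mathsf{1}}=\mathsf{1}$,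 $\widehat{\top}=\top$, with $\widehat{(\Gamma,\Delta)}^{\perp}=(\widehat{\Delta}^{\perp},\widehat{\Gamma}^{\perp})$ on structures. -}

module Defs where

open import Data.Nat using (ℕ)
open import Data.Bool using (Bool; true; false)
open import Data.Maybe using (Maybe; just; nothing)
open import Data.Unit using () renaming (⊤ to Unit)
open import Data.Product using (_×_)
open import Relation.Binary.PropositionalEquality using (_≡_)
open import Relation.Binary.Structures using (IsPreorder)

data SR : Set where
  sC sW sA1 sA2 sE : SR

record Sig : Set₁ where
  field
    I          : Set
    _≼_        : I → I → Set
    isPreorder : IsPreorder _≡_ _≼_
    -- f i s ≡ true  means  s ∈ f(i)
    f          : I → SR → Bool
    upward     : ∀ {i j} (s : SR) → i ≼ j → f i s ≡ true → f j s ≡ true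

data IFm (I : Set) : Set where
  iat  : ℕ → IFm I
  _&ᵢ_ : IFm I → IFm I → IFm I
  _⊕ᵢ_ : IFm I → IFm I → IFm I
  _⊗ᵢ_ : IFm I → IFm I → IFm I
  _⊸_  : IFm I → IFm I → IFm I
  _⟜_  : IFm I → IFm I → IFm I
  ⊤ᵢ   : IFm I
  𝟏ᵢ   : IFm I
  !ᵢ   : I → IFm I → IFm I

data CFm (I : Set) : Set where
  cat  : ℕ → CFm I
  cnat : ℕ → CFm I
  _⊗_  : CFm I → CFm I → CFm I
  _⅋_  : CFm I → CFm I → CFm I
  _⊕_  : CFm I → CFm I → CFm I
  _&_  : CFm I → CFm I → CFm I
  𝟏    : CFm I
  ⊥ᶜ   : CFm I
  𝟎    : CFm I
  ⊤ᶜ   : CFm I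
  ‼    : I → CFm I → CFm I
  ⁇    : I → CFm I → CFm I

neg : ∀ {I} → CFm I → CFm I
neg (cat p)  = cnat p
neg (cnat p) = cat p
neg (A ⊗ B)  = neg B ⅋ neg A
neg (A ⅋ B)  = neg B ⊗ neg A
neg (A ⊕ B)  = neg A & neg B
neg (A & B)  = neg A ⊕ neg B
neg 𝟏        = ⊥ᶜ
neg ⊥ᶜ       = 𝟏
neg 𝟎        = ⊤ᶜ
neg ⊤ᶜ       = 𝟎
neg (‼ i A)  = ⁇ i (neg A)
neg (⁇ i A)  = ‼ i (neg A)

-- Structures: binary trees of formulas, possibly empty.
-- Str A = nothing is the empty structure ∅, with (Γ,∅) = (∅,Γ) = Γ.

data Tree (A : Set) : Set where
  leaf : A → Tree A
  node : Tree A → Tree A → Tree A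

Str : Set → Set
Str A = Maybe (Tree A)

⟨_⟩ : ∀ {A} → A → Str A
⟨ a ⟩ = just (leaf a)

_⨾_ : ∀ {A} → Str A → Str A → Str A
nothing ⨾ y       = y
just x  ⨾ nothing = just x
just x  ⨾ just y  = just (node x y)
infixr 5 _⨾_

data Ctx (A : Set) : Set where
  hole : Ctx A
  inL  : Ctx A → Tree A → Ctx A
  inR  : Tree A → Ctx A → Ctx A

plug : ∀ {A} → Ctx A → Str A → Str A
plug hole      s = s
plug (inL c t) s = plug c s ⨾ just t
plug (inR t c) s = just t ⨾ plug c s

hat : ∀ {I} → IFm I → CFm I
hat (iat p)  = cat p
hat (A &ᵢ B) = hat A & hat B
hat (A ⊕ᵢ B) = hat A ⊕ hat B
hat (A ⊗ᵢ B) = hat A ⊗ hat B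
hat (A ⊸ B)  = neg (hat A) ⅋ hat B
hat (B ⟜ A)  = hat B ⅋ neg (hat A)
hat ⊤ᵢ       = ⊤ᶜ
hat 𝟏ᵢ       = 𝟏
hat (!ᵢ i A) = ‼ i (hat A)

hatT⊥ : ∀ {I} → Tree (IFm I) → Tree (CFm I)
hatT⊥ (leaf A)   = leaf (neg (hat A))
hatT⊥ (node Γ Δ) = node (hatT⊥ Δ) (hatT⊥ Γ)

hatS⊥ : ∀ {I} → Str (IFm I) → Str (CFm I)
hatS⊥ nothing  = nothing
hatS⊥ (just t) = just (hatT⊥ t)

module _ (S : Sig) where
  open Sig S

  data BangAboveT (i : I) : Tree (IFm I) → Set where
    leaf : ∀ {j A} → i ≼ j → BangAboveT i (leaf (!ᵢ j A))
    node : ∀ {Γ Δ} → BangAboveT i Γ → BangAboveT i Δ → BangAboveT i (node Γ Δ)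

  BangAbove : I → Str (IFm I) → Set
  BangAbove i nothing  = Unit
  BangAbove i (just t) = BangAboveT i t

  data QuestAboveT (i : I) : Tree (CFm I) → Set where
    leaf : ∀ {j A} → i ≼ j → QuestAboveT i (leaf (⁇ j A))
    node : ∀ {Γ Δ} → QuestAboveT i Γ → QuestAboveT i Δ → QuestAboveT i (node Γ Δ)

  QuestAbove : I → Str (CFm I) → Set
  QuestAbove i nothing  = Unit
  QuestAbove i (just t) = QuestAboveT i t

  data acLL : Str (IFm I) → IFm I → Set where
    init : ∀ {A} → acLL ⟨ A ⟩ A
    ⊗L   : ∀ {Γ A B C} → acLL (plug Γ (⟨ A ⟩ ⨾ ⟨ B ⟩)) C → acLL (plug Γ ⟨ A ⊗ᵢ B ⟩) C
    ⊗R   : ∀ {Γ Δ A B} → acLL Γ A → acLL Δ B → acLL (Γ ⨾ Δ) (A ⊗ᵢ B)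
    ⊸L   : ∀ {Γ Δ A B C} → acLL Δ A → acLL (plug Γ ⟨ B ⟩) C
           → acLL (plug Γ (Δ ⨾ ⟨ A ⊸ B ⟩)) C
    ⊸R   : ∀ {Γ A B} → acLL (⟨ A ⟩ ⨾ Γ) B → acLL Γ (A ⊸ B)
    ⟜L   : ∀ {Γ Δ A B C} → acLL Δ A → acLL (plug Γ ⟨ B ⟩) C
           → acLL (plug Γ (⟨ B ⟜ A ⟩ ⨾ Δ)) C
    ⟜R   : ∀ {Γ A B} → acLL (Γ ⨾ ⟨ A ⟩) B → acLL Γ (B ⟜ A)
    &L₁  : ∀ {Γ A B C} → acLL (plug Γ ⟨ A ⟩) C → acLL (plug Γ ⟨ A &ᵢ B ⟩) C
    &L₂  : ∀ {Γ A B C} → acLL (plug Γ ⟨ B ⟩) C → acLL (plug Γ ⟨ A &ᵢ B ⟩) C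
    &R   : ∀ {Γ A B} → acLL Γ A → acLL Γ B → acLL Γ (A &ᵢ B)
    ⊕L   : ∀ {Γ A B C} → acLL (plug Γ ⟨ A ⟩) C → acLL (plug Γ ⟨ B ⟩) C
           → acLL (plug Γ ⟨ A ⊕ᵢ B ⟩) C
    ⊕R₁  : ∀ {Γ A B} → acLL Γ A → acLL Γ (A ⊕ᵢ B)
    ⊕R₂  : ∀ {Γ A B} → acLL Γ B → acLL Γ (A ⊕ᵢ B)
    ⊤R   : ∀ {Γ} → acLL Γ ⊤ᵢ
    𝟏L   : ∀ {Γ C} → acLL (plug Γ nothing) C → acLL (plug Γ ⟨ 𝟏ᵢ ⟩) C
    𝟏R   : acLL nothing 𝟏ᵢ
    !L   : ∀ {Γ i A C} → acLL (plug Γ ⟨ A ⟩) C → acLL (plug Γ ⟨ !ᵢ i A ⟩) C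
    !R   : ∀ {Γ i A} → BangAbove i Γ → acLL Γ A → acLL Γ (!ᵢ i A)
    !W   : ∀ {Γ i A C} → f i sW ≡ true
           → acLL (plug Γ nothing) C → acLL (plug Γ ⟨ !ᵢ i A ⟩) C
    !C   : ∀ {Γ i A C} → f i sC ≡ true
           → acLL (plug Γ (⟨ !ᵢ i A ⟩ ⨾ ⟨ !ᵢ i A ⟩)) C → acLL (plug Γ ⟨ !ᵢ i A ⟩) C
    !E₁  : ∀ {Γ Δ i A C} → f i sE ≡ true
           → acLL (plug Γ (just Δ ⨾ ⟨ !ᵢ i A ⟩)) C → acLL (plug Γ (⟨ !ᵢ i A ⟩ ⨾ just Δ)) C
    !E₂  : ∀ {Γ Δ i A C} → f i sE ≡ true
           → acLL (plug Γ (⟨ !ᵢ i A ⟩ ⨾ just Δ)) C → acLL (plug Γ (just Δ ⨾ ⟨ !ᵢ i A ⟩)) C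
    !A1₁ : ∀ {Γ Δ₁ Δ₂ i A C} → f i sA1 ≡ true
           → acLL (plug Γ (just Δ₁ ⨾ (just Δ₂ ⨾ ⟨ !ᵢ i A ⟩))) C
           → acLL (plug Γ ((just Δ₁ ⨾ just Δ₂) ⨾ ⟨ !ᵢ i A ⟩)) C
    !A1₂ : ∀ {Γ Δ₁ Δ₂ i A C} → f i sA1 ≡ true
           → acLL (plug Γ ((just Δ₁ ⨾ just Δ₂) ⨾ ⟨ !ᵢ i A ⟩)) C
           → acLL (plug Γ (just Δ₁ ⨾ (just Δ₂ ⨾ ⟨ !ᵢ i A ⟩))) C
    !A2₁ : ∀ {Γ Δ₁ Δ₂ i A C} → f i sA2 ≡ true
           → acLL (plug Γ ((⟨ !ᵢ i A ⟩ ⨾ just Δ₁) ⨾ just Δ₂)) C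
           → acLL (plug Γ (⟨ !ᵢ i A ⟩ ⨾ (just Δ₁ ⨾ just Δ₂))) C
    !A2₂ : ∀ {Γ Δ₁ Δ₂ i A C} → f i sA2 ≡ true
           → acLL (plug Γ (⟨ !ᵢ i A ⟩ ⨾ (just Δ₁ ⨾ just Δ₂))) C
           → acLL (plug Γ ((⟨ !ᵢ i A ⟩ ⨾ just Δ₁) ⨾ just Δ₂)) C

  data CacLL : Str (CFm I) → Set where
    init : ∀ {A} → CacLL (⟨ neg A ⟩ ⨾ ⟨ A ⟩)
    ex   : ∀ {Γ Δ} → CacLL (Γ ⨾ Δ) → CacLL (Δ ⨾ Γ)
    as₁  : ∀ {Γ Δ Λ} → CacLL ((Γ ⨾ Δ) ⨾ Λ) → CacLL (Γ ⨾ (Δ ⨾ Λ))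
    as₂  : ∀ {Γ Δ Λ} → CacLL (Γ ⨾ (Δ ⨾ Λ)) → CacLL ((Γ ⨾ Δ) ⨾ Λ)
    ⊗R   : ∀ {Γ Δ A B} → CacLL (Γ ⨾ ⟨ A ⟩) → CacLL (Δ ⨾ ⟨ B ⟩)
           → CacLL ((Δ ⨾ Γ) ⨾ ⟨ A ⊗ B ⟩)
    ⅋R   : ∀ {Γ A B} → CacLL (Γ ⨾ (⟨ A ⟩ ⨾ ⟨ B ⟩)) → CacLL (Γ ⨾ ⟨ A ⅋ B ⟩)
    ⊕R₁  : ∀ {Γ A B} → CacLL (Γ ⨾ ⟨ A ⟩) → CacLL (Γ ⨾ ⟨ A ⊕ B ⟩)
    ⊕R₂  : ∀ {Γ A B} → CacLL (Γ ⨾ ⟨ B ⟩) → CacLL (Γ ⨾ ⟨ A ⊕ B ⟩)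
    &R   : ∀ {Γ A B} → CacLL (Γ ⨾ ⟨ A ⟩) → CacLL (Γ ⨾ ⟨ B ⟩) → CacLL (Γ ⨾ ⟨ A & B ⟩)
    𝟏R   : CacLL ⟨ 𝟏 ⟩
    ⊥R   : ∀ {Γ} → CacLL Γ → CacLL (Γ ⨾ ⟨ ⊥ᶜ ⟩)
    ⊤R   : ∀ {Γ} → CacLL (Γ ⨾ ⟨ ⊤ᶜ ⟩)
    ?D   : ∀ {Γ i A} → CacLL (Γ ⨾ ⟨ A ⟩) → CacLL (Γ ⨾ ⟨ ⁇ i A ⟩)
    !P   : ∀ {Γ i A} → QuestAbove i Γ → CacLL (Γ ⨾ ⟨ A ⟩) → CacLL (Γ ⨾ ⟨ ‼ i A ⟩)
    ?W   : ∀ {Γ i A} → f i sW ≡ true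
           → CacLL (plug Γ nothing) → CacLL (plug Γ ⟨ ⁇ i A ⟩)
    ?C   : ∀ {Γ i A} → f i sC ≡ true
           → CacLL (plug Γ (⟨ ⁇ i A ⟩ ⨾ ⟨ ⁇ i A ⟩)) → CacLL (plug Γ ⟨ ⁇ i A ⟩)
    ?E₁  : ∀ {Γ Δ i A} → f i sE ≡ true
           → CacLL (plug Γ (just Δ ⨾ ⟨ ⁇ i A ⟩)) → CacLL (plug Γ (⟨ ⁇ i A ⟩ ⨾ just Δ))
    ?E₂  : ∀ {Γ Δ i A} → f i sE ≡ true
           → CacLL (plug Γ (⟨ ⁇ i A ⟩ ⨾ just Δ)) → CacLL (plug Γ (just Δ ⨾ ⟨ ⁇ i A ⟩))
    ?A1₁ : ∀ {Γ Δ₁ Δ₂ i A} → f i sA1 ≡ true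
           → CacLL (plug Γ (just Δ₁ ⨾ (just Δ₂ ⨾ ⟨ ⁇ i A ⟩)))
           → CacLL (plug Γ ((just Δ₁ ⨾ just Δ₂) ⨾ ⟨ ⁇ i A ⟩))
    ?A1₂ : ∀ {Γ Δ₁ Δ₂ i A} → f i sA1 ≡ true
           → CacLL (plug Γ ((just Δ₁ ⨾ just Δ₂) ⨾ ⟨ ⁇ i A ⟩))
           → CacLL (plug Γ (just Δ₁ ⨾ (just Δ₂ ⨾ ⟨ ⁇ i A ⟩)))
    ?A2₁ : ∀ {Γ Δ₁ Δ₂ i A} → f i sA2 ≡ true
           → CacLL (plug Γ ((⟨ ⁇ i A ⟩ ⨾ just Δ₁) ⨾ just Δ₂))
           → CacLL (plug Γ (⟨ ⁇ i A ⟩ ⨾ (just Δ₁ ⨾ just Δ₂)))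
    ?A2₂ : ∀ {Γ Δ₁ Δ₂ i A} → f i sA2 ≡ true
           → CacLL (plug Γ (⟨ ⁇ i A ⟩ ⨾ (just Δ₁ ⨾ just Δ₂)))
           → CacLL (plug Γ ((⟨ ⁇ i A ⟩ ⨾ just Δ₁) ⨾ just Δ₂))

  OnlyCWE : Set
  OnlyCWE = ∀ (i : I) → (f i sA1 ≡ false) × (f i sA2 ≡ false)

-- Induction on the CacLL derivation proves more: every acLL sequent whose translation is a
-- cyclic rotation of the derived sequent is provable. In a translated sequent the succedent
-- hat A is the only positive formula, all others being negated translations. The last rule
-- either introduces the succedent, which becomes an acLL right rule, or a negated
-- translation, which becomes a left rule; top-level exchange and associativity only rotate
-- the sequent. A sequent of negated translations alone is unprovable (by polarity, no axiom
-- has this form), which sends the succedent of a ⊗ to the premise dictated by the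
-- implication the tensor came from. Structural rules on ? become those on !.

module Submission where

open import Defs
open import Data.Bool using (Bool; true; false; if_then_else_; _∧_; _∨_)
open import Data.Bool.Properties using (∧-zeroʳ)
open import Data.Empty using (⊥; ⊥-elim)
open import Data.Maybe using (just; nothing)
open import Data.Maybe.Properties using (just-injective)
open import Data.Product using (Σ-syntax; _×_; _,_; proj₁; proj₂)
open import Data.Sum using (_⊎_; inj₁; inj₂)
open import Data.Unit using (⊤; tt)
open import Relation.Nullary using (¬_)
open import Relation.Binary.PropositionalEquality
open ≡-Reasoning

-- Polarity and the translation of formulas

module _ {I : Set} where

  neg-involutive : (A : CFm I) → neg (neg A) ≡ A
  neg-involutive (cat _)  = refl
  neg-involutive (cnat _) = refl
  neg-involutive (A ⊗ B)  = cong₂ _⊗_ (neg-involutive A) (neg-involutive B)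
  neg-involutive (A ⅋ B)  = cong₂ _⅋_ (neg-involutive A) (neg-involutive B)
  neg-involutive (A ⊕ B)  = cong₂ _⊕_ (neg-involutive A) (neg-involutive B)
  neg-involutive (A & B)  = cong₂ _&_ (neg-involutive A) (neg-involutive B)
  neg-involutive 𝟏        = refl
  neg-involutive ⊥ᶜ       = refl
  neg-involutive 𝟎        = refl
  neg-involutive ⊤ᶜ       = refl
  neg-involutive (‼ i A)  = cong (‼ i) (neg-involutive A)
  neg-involutive (⁇ i A)  = cong (⁇ i) (neg-involutive A)

  neg-injective : ∀ {A B : CFm I} → neg A ≡ neg B → A ≡ B
  neg-injective {A} {B} e = begin
    A             ≡⟨ neg-involutive A ⟨
    neg (neg A)   ≡⟨ cong neg e ⟩
    neg (neg B)   ≡⟨ neg-involutive B ⟩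
    B             ∎

  positive : CFm I → Bool
  positive (cat _)  = true
  positive (cnat _) = false
  positive (A ⊗ B)  = positive A ∧ positive B
  positive (A ⅋ B)  = positive A ∨ positive B
  positive (A ⊕ B)  = positive A ∨ positive B
  positive (A & B)  = positive A ∧ positive B
  positive 𝟏        = true
  positive ⊥ᶜ       = false
  positive 𝟎        = false
  positive ⊤ᶜ       = true
  positive (‼ _ A)  = positive A
  positive (⁇ _ A)  = positive A

  mutual
    positive-hat : (A : IFm I) → positive (hat A) ≡ true
    positive-hat (iat _)  = refl
    positive-hat (A &ᵢ B) rewrite positive-hat A | positive-hat B = refl
    positive-hat (A ⊕ᵢ B) rewrite positive-hat A = refl
    positive-hat (A ⊗ᵢ B) rewrite positive-hat A | positive-hat B = refl
    positive-hat (A ⊸ B)  rewrite positive-neg-hat A | positive-hat B = refl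
    positive-hat (B ⟜ A)  rewrite positive-hat B = refl
    positive-hat ⊤ᵢ       = refl
    positive-hat 𝟏ᵢ       = refl
    positive-hat (!ᵢ _ A) = positive-hat A

    positive-neg-hat : (A : IFm I) → positive (neg (hat A)) ≡ false
    positive-neg-hat (iat _)  = refl
    positive-neg-hat (A &ᵢ B) rewrite positive-neg-hat A | positive-neg-hat B = refl
    positive-neg-hat (A ⊕ᵢ B) rewrite positive-neg-hat A = refl
    positive-neg-hat (A ⊗ᵢ B) rewrite positive-neg-hat A | positive-neg-hat B = refl
    positive-neg-hat (A ⊸ B)  rewrite positive-neg-hat B = refl
    positive-neg-hat (B ⟜ A)  rewrite positive-neg-hat B = ∧-zeroʳ _
    positive-neg-hat ⊤ᵢ       = refl
    positive-neg-hat 𝟏ᵢ       = refl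
    positive-neg-hat (!ᵢ _ A) = positive-neg-hat A

  hat≢neg-hat : ∀ (A B : IFm I) → hat A ≢ neg (hat B)
  hat≢neg-hat A B e with trans (sym (positive-hat A)) (trans (cong positive e) (positive-neg-hat B))
  ... | ()

  -- unhat⊥ F computes unhat (neg F). The polarity of a component of ⅋ or ⊗ tells which
  -- implication the formula came from; formulas outside the image of hat go to ⊤ᵢ.
  mutual
    unhat : CFm I → IFm I
    unhat (cat p)  = iat p
    unhat (A & B)  = unhat A &ᵢ unhat B
    unhat (A ⊕ B)  = unhat A ⊕ᵢ unhat B
    unhat (A ⊗ B)  = unhat A ⊗ᵢ unhat B
    unhat (A ⅋ B)  = if positive A then unhat A ⟜ unhat⊥ B else unhat⊥ A ⊸ unhat B
    unhat ⊤ᶜ       = ⊤ᵢ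
    unhat 𝟏        = 𝟏ᵢ
    unhat (‼ i A)  = !ᵢ i (unhat A)
    unhat _        = ⊤ᵢ

    unhat⊥ : CFm I → IFm I
    unhat⊥ (cnat p) = iat p
    unhat⊥ (A ⊕ B)  = unhat⊥ A &ᵢ unhat⊥ B
    unhat⊥ (A & B)  = unhat⊥ A ⊕ᵢ unhat⊥ B
    unhat⊥ (A ⅋ B)  = unhat⊥ B ⊗ᵢ unhat⊥ A
    unhat⊥ (A ⊗ B)  = if positive B then unhat B ⊸ unhat⊥ A else unhat⊥ B ⟜ unhat A
    unhat⊥ 𝟎        = ⊤ᵢ
    unhat⊥ ⊥ᶜ       = 𝟏ᵢ
    unhat⊥ (⁇ i A)  = !ᵢ i (unhat⊥ A)
    unhat⊥ _        = ⊤ᵢ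

  mutual
    unhat-hat : (A : IFm I) → unhat (hat A) ≡ A
    unhat-hat (iat _)  = refl
    unhat-hat (A &ᵢ B) = cong₂ _&ᵢ_ (unhat-hat A) (unhat-hat B)
    unhat-hat (A ⊕ᵢ B) = cong₂ _⊕ᵢ_ (unhat-hat A) (unhat-hat B)
    unhat-hat (A ⊗ᵢ B) = cong₂ _⊗ᵢ_ (unhat-hat A) (unhat-hat B)
    unhat-hat (A ⊸ B)  rewrite positive-neg-hat A = cong₂ _⊸_ (unhat⊥-neg-hat A) (unhat-hat B)
    unhat-hat (B ⟜ A)  rewrite positive-hat B = cong₂ _⟜_ (unhat-hat B) (unhat⊥-neg-hat A)
    unhat-hat ⊤ᵢ       = refl
    unhat-hat 𝟏ᵢ       = refl
    unhat-hat (!ᵢ i A) = cong (!ᵢ i) (unhat-hat A)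

    unhat⊥-neg-hat : (A : IFm I) → unhat⊥ (neg (hat A)) ≡ A
    unhat⊥-neg-hat (iat _)  = refl
    unhat⊥-neg-hat (A &ᵢ B) = cong₂ _&ᵢ_ (unhat⊥-neg-hat A) (unhat⊥-neg-hat B)
    unhat⊥-neg-hat (A ⊕ᵢ B) = cong₂ _⊕ᵢ_ (unhat⊥-neg-hat A) (unhat⊥-neg-hat B)
    unhat⊥-neg-hat (A ⊗ᵢ B) = cong₂ _⊗ᵢ_ (unhat⊥-neg-hat A) (unhat⊥-neg-hat B)
    unhat⊥-neg-hat (A ⊸ B)  rewrite neg-involutive (hat A) | positive-hat A =
      cong₂ _⊸_ (unhat-hat A) (unhat⊥-neg-hat B)
    unhat⊥-neg-hat (B ⟜ A)  rewrite neg-involutive (hat A) | positive-neg-hat B =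
      cong₂ _⟜_ (unhat⊥-neg-hat B) (unhat-hat A)
    unhat⊥-neg-hat ⊤ᵢ       = refl
    unhat⊥-neg-hat 𝟏ᵢ       = refl
    unhat⊥-neg-hat (!ᵢ i A) = cong (!ᵢ i) (unhat⊥-neg-hat A)

  hat-injective : ∀ {A B : IFm I} → hat A ≡ hat B → A ≡ B
  hat-injective {A} {B} e = begin
    A             ≡⟨ unhat-hat A ⟨
    unhat (hat A) ≡⟨ cong unhat e ⟩
    unhat (hat B) ≡⟨ unhat-hat B ⟩
    B             ∎

  -- The graphs of hat and of neg ∘ hat, one step unfolded: matching on HatView A (F₁ ⅋ F₂)
  -- leaves exactly the cases whose translation is a par, the others being refuted by unification.
  data HatView : IFm I → CFm I → Set where
    iat  : ∀ p → HatView (iat p) (cat p)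
    _&ᵢ_ : ∀ A B → HatView (A &ᵢ B) (hat A & hat B)
    _⊕ᵢ_ : ∀ A B → HatView (A ⊕ᵢ B) (hat A ⊕ hat B)
    _⊗ᵢ_ : ∀ A B → HatView (A ⊗ᵢ B) (hat A ⊗ hat B)
    _⊸_  : ∀ A B → HatView (A ⊸ B) (neg (hat A) ⅋ hat B)
    _⟜_  : ∀ B A → HatView (B ⟜ A) (hat B ⅋ neg (hat A))
    ⊤ᵢ   : HatView ⊤ᵢ ⊤ᶜ
    𝟏ᵢ   : HatView 𝟏ᵢ 𝟏
    !ᵢ   : ∀ i A → HatView (!ᵢ i A) (‼ i (hat A))

  data Hat⊥View : IFm I → CFm I → Set where
    iat  : ∀ p → Hat⊥View (iat p) (cnat p)
    _&ᵢ_ : ∀ A B → Hat⊥View (A &ᵢ B) (neg (hat A) ⊕ neg (hat B))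
    _⊕ᵢ_ : ∀ A B → Hat⊥View (A ⊕ᵢ B) (neg (hat A) & neg (hat B))
    _⊗ᵢ_ : ∀ A B → Hat⊥View (A ⊗ᵢ B) (neg (hat B) ⅋ neg (hat A))
    _⊸_  : ∀ A B → Hat⊥View (A ⊸ B) (neg (hat B) ⊗ neg (neg (hat A)))
    _⟜_  : ∀ B A → Hat⊥View (B ⟜ A) (neg (neg (hat A)) ⊗ neg (hat B))
    ⊤ᵢ   : Hat⊥View ⊤ᵢ 𝟎
    𝟏ᵢ   : Hat⊥View 𝟏ᵢ ⊥ᶜ
    !ᵢ   : ∀ i A → Hat⊥View (!ᵢ i A) (⁇ i (neg (hat A)))

  hat-view : (A : IFm I) → HatView A (hat A)
  hat-view (iat p)  = iat p
  hat-view (A &ᵢ B) = A &ᵢ B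
  hat-view (A ⊕ᵢ B) = A ⊕ᵢ B
  hat-view (A ⊗ᵢ B) = A ⊗ᵢ B
  hat-view (A ⊸ B)  = A ⊸ B
  hat-view (B ⟜ A)  = B ⟜ A
  hat-view ⊤ᵢ       = ⊤ᵢ
  hat-view 𝟏ᵢ       = 𝟏ᵢ
  hat-view (!ᵢ i A) = !ᵢ i A

  hat⊥-view : (A : IFm I) → Hat⊥View A (neg (hat A))
  hat⊥-view (iat p)  = iat p
  hat⊥-view (A &ᵢ B) = A &ᵢ B
  hat⊥-view (A ⊕ᵢ B) = A ⊕ᵢ B
  hat⊥-view (A ⊗ᵢ B) = A ⊗ᵢ B
  hat⊥-view (A ⊸ B)  = A ⊸ B
  hat⊥-view (B ⟜ A)  = B ⟜ A
  hat⊥-view ⊤ᵢ       = ⊤ᵢ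
  hat⊥-view 𝟏ᵢ       = 𝟏ᵢ
  hat⊥-view (!ᵢ i A) = !ᵢ i A

  hat-view-sound : ∀ {A F} → HatView A F → hat A ≡ F
  hat-view-sound (iat _)  = refl
  hat-view-sound (_ &ᵢ _) = refl
  hat-view-sound (_ ⊕ᵢ _) = refl
  hat-view-sound (_ ⊗ᵢ _) = refl
  hat-view-sound (_ ⊸ _)  = refl
  hat-view-sound (_ ⟜ _)  = refl
  hat-view-sound ⊤ᵢ       = refl
  hat-view-sound 𝟏ᵢ       = refl
  hat-view-sound (!ᵢ _ _) = refl

  hat⊥-view-sound : ∀ {A F} → Hat⊥View A F → neg (hat A) ≡ F
  hat⊥-view-sound (iat _)  = refl
  hat⊥-view-sound (_ &ᵢ _) = refl
  hat⊥-view-sound (_ ⊕ᵢ _) = refl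
  hat⊥-view-sound (_ ⊗ᵢ _) = refl
  hat⊥-view-sound (_ ⊸ _)  = refl
  hat⊥-view-sound (_ ⟜ _)  = refl
  hat⊥-view-sound ⊤ᵢ       = refl
  hat⊥-view-sound 𝟏ᵢ       = refl
  hat⊥-view-sound (!ᵢ _ _) = refl

  view-hat : ∀ {A F} → hat A ≡ F → HatView A F
  view-hat {A} e = subst (HatView A) e (hat-view A)

  Negated : CFm I → Set
  Negated F = Σ[ A ∈ IFm I ] Hat⊥View A F

  negated : (A : IFm I) → Negated (neg (hat A))
  negated A = A , hat⊥-view A

  negated-neg : ∀ {F} → Negated F → ¬ Negated (neg F)
  negated-neg (A , v) (B , w) rewrite sym (hat⊥-view-sound v) =
    hat≢neg-hat A B (trans (sym (neg-involutive (hat A))) (sym (hat⊥-view-sound w)))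

  hat≢⁇ : ∀ (A : IFm I) {i F} → hat A ≢ ⁇ i F
  hat≢⁇ A e with view-hat e
  ... | ()

-- Structures, contexts and cyclic rotation

module _ {A : Set} where

  ⨾-identityʳ : (X : Str A) → X ⨾ nothing ≡ X
  ⨾-identityʳ nothing  = refl
  ⨾-identityʳ (just _) = refl

  node-injective : ∀ {l r l′ r′ : Tree A} → node l r ≡ node l′ r′ → l ≡ l′ × r ≡ r′
  node-injective refl = refl , refl

  plugᵀ : Ctx A → Tree A → Tree A
  plugᵀ hole      x = x
  plugᵀ (inL c t) x = node (plugᵀ c x) t
  plugᵀ (inR t c) x = node t (plugᵀ c x)

  plug-just : (c : Ctx A) (x : Tree A) → plug c (just x) ≡ just (plugᵀ c x)
  plug-just hole      x = refl
  plug-just (inL c t) x rewrite plug-just c x = refl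
  plug-just (inR t c) x rewrite plug-just c x = refl

  plug-nonempty : (c : Ctx A) {x : Tree A} → plug c (just x) ≢ nothing
  plug-nonempty c {x} e with trans (sym (plug-just c x)) e
  ... | ()

  plugᵀ-≡ : ∀ c {x} c′ {x′} → plug c (just x) ≡ plug c′ (just x′) → plugᵀ c x ≡ plugᵀ c′ x′
  plugᵀ-≡ c {x} c′ {x′} e = just-injective (trans (sym (plug-just c x)) (trans e (plug-just c′ x′)))

  plugᵀ-leaf⁻¹ : ∀ c {o a} → plugᵀ c (leaf o) ≡ leaf a → c ≡ hole × o ≡ a
  plugᵀ-leaf⁻¹ hole refl = refl , refl

  plug-leaf⁻¹ : ∀ c {o a} → plug c ⟨ o ⟩ ≡ ⟨ a ⟩ → c ≡ hole × o ≡ a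
  plug-leaf⁻¹ c {o} e = plugᵀ-leaf⁻¹ c (just-injective (trans (sym (plug-just c (leaf o))) e))

  _⨾ʳ_ : Ctx A → Str A → Ctx A
  c ⨾ʳ nothing = c
  c ⨾ʳ just t  = inL c t

  _⨾ˡ_ : Str A → Ctx A → Ctx A
  nothing ⨾ˡ c = c
  just t  ⨾ˡ c = inR t c

  infixl 5 _⨾ʳ_
  infixr 5 _⨾ˡ_

  plug-⨾ʳ : (c : Ctx A) (Y s : Str A) → plug (c ⨾ʳ Y) s ≡ plug c s ⨾ Y
  plug-⨾ʳ c nothing  s = sym (⨾-identityʳ (plug c s))
  plug-⨾ʳ c (just _) s = refl

  plug-⨾ˡ : (X : Str A) (c : Ctx A) (s : Str A) → plug (X ⨾ˡ c) s ≡ X ⨾ plug c s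
  plug-⨾ˡ nothing  c s = refl
  plug-⨾ˡ (just _) c s = refl

  _∘ᶜ_ : Ctx A → Ctx A → Ctx A
  hole    ∘ᶜ d = d
  inL c t ∘ᶜ d = inL (c ∘ᶜ d) t
  inR t c ∘ᶜ d = inR t (c ∘ᶜ d)

  plug-∘ᶜ : (c d : Ctx A) (s : Str A) → plug (c ∘ᶜ d) s ≡ plug c (plug d s)
  plug-∘ᶜ hole      d s = refl
  plug-∘ᶜ (inL c t) d s = cong (_⨾ just t) (plug-∘ᶜ c d s)
  plug-∘ᶜ (inR t c) d s = cong (just t ⨾_) (plug-∘ᶜ c d s)

  data Location (o : A) (X Y : Str A) : Ctx A → Set where
    inˡ : ∀ d → plug d ⟨ o ⟩ ≡ X → Location o X Y (d ⨾ʳ Y)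
    inʳ : ∀ d → plug d ⟨ o ⟩ ≡ Y → Location o X Y (X ⨾ˡ d)

  locate : ∀ {o} c X Y → plug c ⟨ o ⟩ ≡ X ⨾ Y → Location o X Y c
  locate c nothing  nothing  e = ⊥-elim (plug-nonempty c e)
  locate c nothing  (just _) e = inʳ c e
  locate c (just _) nothing  e = inˡ c e
  locate {o} c (just _) (just _) e with c | just-injective (trans (sym (plug-just c (leaf o))) e)
  ... | inL d _ | refl = inˡ d (plug-just d (leaf o))
  ... | inR _ d | refl = inʳ d (plug-just d (leaf o))

  -- Reading a sequent cyclically from just after the hole: plug c s and rest c ⨾ s differ
  -- only by the top-level exchange and associativity rules.
  rotate : Ctx A → Str A → Str A
  rotate hole      acc = acc
  rotate (inL c t) acc = rotate c (just t ⨾ acc)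
  rotate (inR t c) acc = rotate c (acc ⨾ just t)

  rest : Ctx A → Str A
  rest c = rotate c nothing

  turn : Ctx A → Ctx A
  turn hole      = hole
  turn (inL c t) = turn c ∘ᶜ inR t hole
  turn (inR t c) = turn c ∘ᶜ inL hole t

  rotate-turn : ∀ c acc → rotate c acc ≡ plug (turn c) acc
  rotate-turn hole      acc = refl
  rotate-turn (inL c t) acc = trans (rotate-turn c _) (sym (plug-∘ᶜ (turn c) (inR t hole) acc))
  rotate-turn (inR t c) acc = trans (rotate-turn c _) (sym (plug-∘ᶜ (turn c) (inL hole t) acc))

  rotate-⨾ʳ : ∀ c Y acc → rotate (c ⨾ʳ Y) acc ≡ rotate c (Y ⨾ acc)
  rotate-⨾ʳ c nothing  acc = refl
  rotate-⨾ʳ c (just _) acc = refl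

  rotate-⨾ˡ : ∀ X c acc → rotate (X ⨾ˡ c) acc ≡ rotate c (acc ⨾ X)
  rotate-⨾ˡ nothing  c acc = cong (rotate c) (sym (⨾-identityʳ acc))
  rotate-⨾ˡ (just _) c acc = refl

  rotate-∘ᶜ : ∀ c d acc → rotate (c ∘ᶜ d) acc ≡ rotate d (rotate c acc)
  rotate-∘ᶜ hole      d acc = refl
  rotate-∘ᶜ (inL c t) d acc = rotate-∘ᶜ c d _
  rotate-∘ᶜ (inR t c) d acc = rotate-∘ᶜ c d _

  rest-⨾ʳ : ∀ c Y → rest (c ⨾ʳ Y) ≡ rotate c Y
  rest-⨾ʳ c Y = trans (rotate-⨾ʳ c Y nothing) (cong (rotate c) (⨾-identityʳ Y))

  rest-⨾ˡ : ∀ X c → rest (X ⨾ˡ c) ≡ rotate c X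
  rest-⨾ˡ X c = rotate-⨾ˡ X c nothing

  turn-⨾ʳ : ∀ c Y s → plug (turn (c ⨾ʳ Y)) s ≡ plug (turn c) (Y ⨾ s)
  turn-⨾ʳ c Y s = begin
    plug (turn (c ⨾ʳ Y)) s ≡⟨ rotate-turn (c ⨾ʳ Y) s ⟨
    rotate (c ⨾ʳ Y) s      ≡⟨ rotate-⨾ʳ c Y s ⟩
    rotate c (Y ⨾ s)       ≡⟨ rotate-turn c (Y ⨾ s) ⟩
    plug (turn c) (Y ⨾ s)  ∎

  turn-⨾ˡ : ∀ X c s → plug (turn (X ⨾ˡ c)) s ≡ plug (turn c) (s ⨾ X)
  turn-⨾ˡ X c s = begin
    plug (turn (X ⨾ˡ c)) s ≡⟨ rotate-turn (X ⨾ˡ c) s ⟨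
    rotate (X ⨾ˡ c) s      ≡⟨ rotate-⨾ˡ X c s ⟩
    rotate c (s ⨾ X)       ≡⟨ rotate-turn c (s ⨾ X) ⟩
    plug (turn c) (s ⨾ X)  ∎

  rest-exchange : ∀ d X → rest (d ⨾ʳ X) ≡ rest (X ⨾ˡ d)
  rest-exchange d X = trans (rest-⨾ʳ d X) (sym (rest-⨾ˡ X d))

  rest-assocʳ : ∀ d Δ Λ → rest ((d ⨾ʳ Δ) ⨾ʳ Λ) ≡ rest (d ⨾ʳ (Δ ⨾ Λ))
  rest-assocʳ d Δ Λ = trans (rest-⨾ʳ (d ⨾ʳ Δ) Λ) (trans (rotate-⨾ʳ d Δ Λ) (sym (rest-⨾ʳ d (Δ ⨾ Λ))))

  rest-assocˡ : ∀ Γ Δ d → rest (Γ ⨾ˡ (Δ ⨾ˡ d)) ≡ rest ((Γ ⨾ Δ) ⨾ˡ d)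
  rest-assocˡ Γ Δ d = trans (rest-⨾ˡ Γ (Δ ⨾ˡ d)) (trans (rotate-⨾ˡ Δ d Γ) (sym (rest-⨾ˡ (Γ ⨾ Δ) d)))

  rest-assoc : ∀ Γ d Λ → rest (Γ ⨾ˡ (d ⨾ʳ Λ)) ≡ rest ((Γ ⨾ˡ d) ⨾ʳ Λ)
  rest-assoc Γ d Λ = trans (rest-⨾ˡ Γ (d ⨾ʳ Λ)) (trans (rotate-⨾ʳ d Λ Γ)
    (sym (trans (rest-⨾ʳ (Γ ⨾ˡ d) Λ) (rotate-⨾ˡ Γ d Λ))))

  -- Contexts with two holes, which fork apart at some node; fill₁ fills the first hole and
  -- keeps the second as the hole of an ordinary context.
  data Ctx₂ : Set where
    inL₂  : Ctx₂ → Tree A → Ctx₂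
    inR₂  : Tree A → Ctx₂ → Ctx₂
    forkˡ : Ctx A → Ctx A → Ctx₂
    forkʳ : Ctx A → Ctx A → Ctx₂

  fill₁ : Ctx₂ → Str A → Ctx A
  fill₁ (inL₂ K t)  s = inL (fill₁ K s) t
  fill₁ (inR₂ t K)  s = inR t (fill₁ K s)
  fill₁ (forkˡ a b) s = plug a s ⨾ˡ b
  fill₁ (forkʳ b a) s = b ⨾ʳ plug a s

  turn₂ : Ctx₂ → Str A → Ctx A
  turn₂ (inL₂ K t)  acc = turn₂ K (just t ⨾ acc)
  turn₂ (inR₂ t K)  acc = turn₂ K (acc ⨾ just t)
  turn₂ (forkˡ a b) acc = turn b ∘ᶜ ((acc ⨾ˡ hole) ∘ᶜ a)
  turn₂ (forkʳ b a) acc = turn b ∘ᶜ ((hole ⨾ʳ acc) ∘ᶜ a)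

  rotate-fill₁ : ∀ K acc s → rotate (fill₁ K s) acc ≡ plug (turn₂ K acc) s
  rotate-fill₁ (inL₂ K t)  acc s = rotate-fill₁ K _ s
  rotate-fill₁ (inR₂ t K)  acc s = rotate-fill₁ K _ s
  rotate-fill₁ (forkˡ a b) acc s = begin
    rotate (plug a s ⨾ˡ b) acc                         ≡⟨ rotate-⨾ˡ (plug a s) b acc ⟩
    rotate b (acc ⨾ plug a s)                          ≡⟨ rotate-turn b _ ⟩
    plug (turn b) (acc ⨾ plug a s)                     ≡⟨ cong (plug (turn b)) (plug-⨾ˡ acc hole (plug a s)) ⟨
    plug (turn b) (plug (acc ⨾ˡ hole) (plug a s))      ≡⟨ cong (plug (turn b)) (plug-∘ᶜ (acc ⨾ˡ hole) a s) ⟨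
    plug (turn b) (plug ((acc ⨾ˡ hole) ∘ᶜ a) s)        ≡⟨ plug-∘ᶜ (turn b) _ s ⟨
    plug (turn b ∘ᶜ ((acc ⨾ˡ hole) ∘ᶜ a)) s            ∎
  rotate-fill₁ (forkʳ b a) acc s = begin
    rotate (b ⨾ʳ plug a s) acc                         ≡⟨ rotate-⨾ʳ b (plug a s) acc ⟩
    rotate b (plug a s ⨾ acc)                          ≡⟨ rotate-turn b _ ⟩
    plug (turn b) (plug a s ⨾ acc)                     ≡⟨ cong (plug (turn b)) (plug-⨾ʳ hole acc (plug a s)) ⟨
    plug (turn b) (plug (hole ⨾ʳ acc) (plug a s))      ≡⟨ cong (plug (turn b)) (plug-∘ᶜ (hole ⨾ʳ acc) a s) ⟨
    plug (turn b) (plug ((hole ⨾ʳ acc) ∘ᶜ a) s)        ≡⟨ plug-∘ᶜ (turn b) _ s ⟨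
    plug (turn b ∘ᶜ ((hole ⨾ʳ acc) ∘ᶜ a)) s            ∎

  data Overlap (e : Ctx A) (x : Tree A) (o : A) : Ctx A → Set where
    nested : ∀ d → x ≡ plugᵀ d (leaf o) → Overlap e x o (e ∘ᶜ d)
    apart  : ∀ K → (∀ s → plug e s ≡ plug (fill₁ K s) ⟨ o ⟩) → Overlap e x o (fill₁ K (just x))

  overlap-view : ∀ e c {x : Tree A} {o : A} → plugᵀ e x ≡ plugᵀ c (leaf o) → Overlap e x o c
  overlap-view hole c q = nested c q
  overlap-view (inL e t) (inL c _) q with node-injective q
  ... | q′ , refl with overlap-view e c q′
  ...   | nested d q″ = nested d q″
  ...   | apart K h   = apart (inL₂ K t) (λ s → cong (_⨾ just t) (h s))
  overlap-view (inR t e) (inR _ c) q with node-injective q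
  ... | refl , q′ with overlap-view e c q′
  ...   | nested d q″ = nested d q″
  ...   | apart K h   = apart (inR₂ t K) (λ s → cong (just t ⨾_) (h s))
  overlap-view (inL e _) (inR _ c) {x} {o} q with node-injective q
  ... | refl , refl = subst (Overlap _ x o) (cong (_⨾ˡ c) (plug-just e x)) (apart (forkˡ e c) λ s →
        trans (cong (plug e s ⨾_) (sym (plug-just c (leaf o)))) (sym (plug-⨾ˡ (plug e s) c _)))
  overlap-view (inR _ e) (inL c _) {x} {o} q with node-injective q
  ... | refl , refl = subst (Overlap _ x o) (cong (c ⨾ʳ_) (plug-just e x)) (apart (forkʳ c e) λ s →
        trans (cong (_⨾ plug e s) (sym (plug-just c (leaf o)))) (sym (plug-⨾ʳ c (plug e s) _)))

  data AllT (P : A → Set) : Tree A → Set where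
    leaf : ∀ {a} → P a → AllT P (leaf a)
    node : ∀ {l r} → AllT P l → AllT P r → AllT P (node l r)

  All : (A → Set) → Str A → Set
  All P nothing  = ⊤
  All P (just t) = AllT P t

  All-⨾⁻ : ∀ {P} X Y → All P (X ⨾ Y) → All P X × All P Y
  All-⨾⁻ nothing  _        ps          = tt , ps
  All-⨾⁻ (just _) nothing  ps          = ps , tt
  All-⨾⁻ (just _) (just _) (node p q) = p , q

  All-⨾⁺ : ∀ {P} X Y → All P X → All P Y → All P (X ⨾ Y)
  All-⨾⁺ nothing  _        _ q = q
  All-⨾⁺ (just _) nothing  p _ = p
  All-⨾⁺ (just _) (just _) p q = node p q

  All-plug : ∀ {P} c {s s′} → (All P s → All P s′) → All P (plug c s) → All P (plug c s′)
  All-plug hole      f ps = f ps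
  All-plug (inL c t) f ps with All-⨾⁻ (plug c _) (just t) ps
  ... | p , q = All-⨾⁺ (plug c _) (just t) (All-plug c f p) q
  All-plug (inR t c) f ps with All-⨾⁻ (just t) (plug c _) ps
  ... | p , q = All-⨾⁺ (just t) (plug c _) p (All-plug c f q)

-- The translation of structures and its inversion

module _ {I : Set} where

  hatS⊥-⨾ : (X Y : Str (IFm I)) → hatS⊥ (X ⨾ Y) ≡ hatS⊥ Y ⨾ hatS⊥ X
  hatS⊥-⨾ nothing  nothing  = refl
  hatS⊥-⨾ nothing  (just _) = refl
  hatS⊥-⨾ (just _) nothing  = refl
  hatS⊥-⨾ (just _) (just _) = refl

  hatC⊥ : Ctx (IFm I) → Ctx (CFm I)
  hatC⊥ hole      = hole
  hatC⊥ (inL c t) = inR (hatT⊥ t) (hatC⊥ c)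
  hatC⊥ (inR t c) = inL (hatC⊥ c) (hatT⊥ t)

  hatS⊥-plug : ∀ c u → hatS⊥ (plug c u) ≡ plug (hatC⊥ c) (hatS⊥ u)
  hatS⊥-plug hole      u = refl
  hatS⊥-plug (inL c t) u = trans (hatS⊥-⨾ (plug c u) (just t)) (cong (just (hatT⊥ t) ⨾_) (hatS⊥-plug c u))
  hatS⊥-plug (inR t c) u = trans (hatS⊥-⨾ (just t) (plug c u)) (cong (_⨾ just (hatT⊥ t)) (hatS⊥-plug c u))

  hatS⊥-negated : ∀ G → All Negated (hatS⊥ G)
  hatS⊥-negated nothing  = tt
  hatS⊥-negated (just t) = go t
    where
    go : (t : Tree (IFm I)) → AllT Negated (hatT⊥ t)
    go (leaf A)   = leaf (negated A)
    go (node l r) = node (go r) (go l)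

  hatS⊥-nothing⁻¹ : ∀ (G : Str (IFm I)) → hatS⊥ G ≡ nothing → G ≡ nothing
  hatS⊥-nothing⁻¹ nothing refl = refl

  hatS⊥-⨾⁻¹ : ∀ G X Y → hatS⊥ G ≡ X ⨾ Y →
    Σ[ G₁ ∈ Str (IFm I) ] Σ[ G₂ ∈ Str (IFm I) ] G ≡ G₁ ⨾ G₂ × hatS⊥ G₂ ≡ X × hatS⊥ G₁ ≡ Y
  hatS⊥-⨾⁻¹ G nothing  _ e = G , nothing , sym (⨾-identityʳ G) , refl , e
  hatS⊥-⨾⁻¹ G (just _) nothing  e = nothing , G , refl , e , refl
  hatS⊥-⨾⁻¹ (just (node l r)) (just _) (just _) refl = just l , just r , refl , refl , refl

  hatT⊥-leaf⁻¹ : ∀ y {F} → hatT⊥ y ≡ leaf F → Σ[ A ∈ IFm I ] y ≡ leaf A × Hat⊥View A F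
  hatT⊥-leaf⁻¹ (leaf A) refl = A , refl , hat⊥-view A

  hatS⊥-leaf⁻¹ : ∀ G {F} → hatS⊥ G ≡ ⟨ F ⟩ → Σ[ A ∈ IFm I ] G ≡ ⟨ A ⟩ × Hat⊥View A F
  hatS⊥-leaf⁻¹ (just (leaf A)) refl = A , refl , hat⊥-view A

  hatT⊥-plug⁻¹ : ∀ K g {x} → hatT⊥ g ≡ plugᵀ K x →
    Σ[ R ∈ Ctx (IFm I) ] Σ[ y ∈ Tree (IFm I) ] just g ≡ plug R (just y) × hatC⊥ R ≡ K × hatT⊥ y ≡ x
  hatT⊥-plug⁻¹ hole g q = hole , g , refl , refl , q
  hatT⊥-plug⁻¹ (inL K _) (node l r) q with node-injective q
  ... | q′ , refl with hatT⊥-plug⁻¹ K r q′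
  ...   | R , y , e , hR , hy = inR l R , y , cong (just l ⨾_) e , cong (λ K′ → inL K′ (hatT⊥ l)) hR , hy
  hatT⊥-plug⁻¹ (inR _ K) (node l r) q with node-injective q
  ... | refl , q′ with hatT⊥-plug⁻¹ K l q′
  ...   | R , y , e , hR , hy = inL R r , y , cong (_⨾ just r) e , cong (inR (hatT⊥ r)) hR , hy

  hatS⊥-plug⁻¹ : ∀ K G {x} → hatS⊥ G ≡ plug K (just x) →
    Σ[ R ∈ Ctx (IFm I) ] Σ[ y ∈ Tree (IFm I) ] G ≡ plug R (just y) × hatC⊥ R ≡ K × hatT⊥ y ≡ x
  hatS⊥-plug⁻¹ K nothing  e = ⊥-elim (plug-nonempty K (sym e))
  hatS⊥-plug⁻¹ K (just g) {x} e = hatT⊥-plug⁻¹ K g (just-injective (trans e (plug-just K x)))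

  hatS⊥-plug-⟨⟩⨾⁻¹ : ∀ K G {F} X → hatS⊥ G ≡ plug K (⟨ F ⟩ ⨾ X) →
    Σ[ R ∈ Ctx (IFm I) ] Σ[ Y ∈ Str (IFm I) ] Σ[ Z ∈ IFm I ]
      G ≡ plug R (Y ⨾ ⟨ Z ⟩) × hatC⊥ R ≡ K × hatS⊥ Y ≡ X × Hat⊥View Z F
  hatS⊥-plug-⟨⟩⨾⁻¹ K G nothing e with hatS⊥-plug⁻¹ K G e
  ... | R , y , refl , hR , hy with hatT⊥-leaf⁻¹ y hy
  ...   | Z , refl , v = R , nothing , Z , refl , hR , refl , v
  hatS⊥-plug-⟨⟩⨾⁻¹ K G (just _) e with hatS⊥-plug⁻¹ K G e
  ... | R , node l r , refl , hR , hy with node-injective hy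
  ...   | hr , refl with hatT⊥-leaf⁻¹ r hr
  ...     | Z , refl , v = R , just l , Z , refl , hR , refl , v

  hatS⊥-plug-⨾⟨⟩⁻¹ : ∀ K G {F} X → hatS⊥ G ≡ plug K (X ⨾ ⟨ F ⟩) →
    Σ[ R ∈ Ctx (IFm I) ] Σ[ Y ∈ Str (IFm I) ] Σ[ Z ∈ IFm I ]
      G ≡ plug R (⟨ Z ⟩ ⨾ Y) × hatC⊥ R ≡ K × hatS⊥ Y ≡ X × Hat⊥View Z F
  hatS⊥-plug-⨾⟨⟩⁻¹ K G nothing e with hatS⊥-plug⁻¹ K G e
  ... | R , y , refl , hR , hy with hatT⊥-leaf⁻¹ y hy
  ...   | Z , refl , v = R , nothing , Z , refl , hR , refl , v
  hatS⊥-plug-⨾⟨⟩⁻¹ K G (just _) e with hatS⊥-plug⁻¹ K G e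
  ... | R , node l r , refl , hR , hy with node-injective hy
  ...   | refl , hl with hatT⊥-leaf⁻¹ l hl
  ...     | Z , refl , v = R , just r , Z , refl , hR , refl , v

-- Sequents of negated translations are unprovable

module _ (S : Sig) where
  open Sig S

  negated-unprovable : ∀ {Θ} → CacLL S Θ → ¬ All Negated Θ
  negated-unprovable init (node (leaf n) (leaf m)) = negated-neg m n
  negated-unprovable (ex {Γ} {Δ} d) ns with All-⨾⁻ Δ Γ ns
  ... | p , q = negated-unprovable d (All-⨾⁺ Γ Δ q p)
  negated-unprovable (as₁ {Γ} {Δ} {Λ} d) ns with All-⨾⁻ Γ (Δ ⨾ Λ) ns
  ... | p , qr with All-⨾⁻ Δ Λ qr
  ...   | q , r = negated-unprovable d (All-⨾⁺ (Γ ⨾ Δ) Λ (All-⨾⁺ Γ Δ p q) r)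
  negated-unprovable (as₂ {Γ} {Δ} {Λ} d) ns with All-⨾⁻ (Γ ⨾ Δ) Λ ns
  ... | pq , r with All-⨾⁻ Γ Δ pq
  ...   | p , q = negated-unprovable d (All-⨾⁺ Γ (Δ ⨾ Λ) p (All-⨾⁺ Δ Λ q r))
  negated-unprovable (⊗R {Γ} {Δ} d₁ d₂) ns with All-⨾⁻ (Δ ⨾ Γ) _ ns
  ... | ps , leaf (_ , _ ⊸ Y) =
    negated-unprovable d₁ (All-⨾⁺ Γ _ (proj₂ (All-⨾⁻ Δ Γ ps)) (leaf (negated Y)))
  ... | ps , leaf (_ , Y ⟜ _) =
    negated-unprovable d₂ (All-⨾⁺ Δ _ (proj₁ (All-⨾⁻ Δ Γ ps)) (leaf (negated Y)))
  negated-unprovable (⅋R {Γ} d) ns with All-⨾⁻ Γ _ ns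
  ... | ps , leaf (_ , X ⊗ᵢ Y) =
    negated-unprovable d (All-⨾⁺ Γ _ ps (node (leaf (negated Y)) (leaf (negated X))))
  negated-unprovable (⊕R₁ {Γ} d) ns with All-⨾⁻ Γ _ ns
  ... | ps , leaf (_ , X &ᵢ _) = negated-unprovable d (All-⨾⁺ Γ _ ps (leaf (negated X)))
  negated-unprovable (⊕R₂ {Γ} d) ns with All-⨾⁻ Γ _ ns
  ... | ps , leaf (_ , _ &ᵢ Y) = negated-unprovable d (All-⨾⁺ Γ _ ps (leaf (negated Y)))
  negated-unprovable (&R {Γ} d₁ _) ns with All-⨾⁻ Γ _ ns
  ... | ps , leaf (_ , X ⊕ᵢ _) = negated-unprovable d₁ (All-⨾⁺ Γ _ ps (leaf (negated X)))
  negated-unprovable 𝟏R (leaf (_ , ()))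
  negated-unprovable (⊥R {Γ} d) ns = negated-unprovable d (proj₁ (All-⨾⁻ Γ _ ns))
  negated-unprovable (⊤R {Γ}) ns with All-⨾⁻ Γ _ ns
  ... | _ , leaf (_ , ())
  negated-unprovable (?D {Γ} d) ns with All-⨾⁻ Γ _ ns
  ... | ps , leaf (_ , !ᵢ _ X) = negated-unprovable d (All-⨾⁺ Γ _ ps (leaf (negated X)))
  negated-unprovable (!P {Γ} _ _) ns with All-⨾⁻ Γ _ ns
  ... | _ , leaf (_ , ())
  negated-unprovable (?W {Γ} _ d) ns = negated-unprovable d (All-plug Γ (λ _ → tt) ns)
  negated-unprovable (?C {Γ} _ d) ns =
    negated-unprovable d (All-plug Γ (λ { (leaf n) → node (leaf n) (leaf n) }) ns)
  negated-unprovable (?E₁ {Γ} _ d) ns = negated-unprovable d (All-plug Γ (λ { (node p q) → node q p }) ns)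
  negated-unprovable (?E₂ {Γ} _ d) ns = negated-unprovable d (All-plug Γ (λ { (node p q) → node q p }) ns)
  negated-unprovable (?A1₁ {Γ} _ d) ns =
    negated-unprovable d (All-plug Γ (λ { (node (node p q) r) → node p (node q r) }) ns)
  negated-unprovable (?A1₂ {Γ} _ d) ns =
    negated-unprovable d (All-plug Γ (λ { (node p (node q r)) → node (node p q) r }) ns)
  negated-unprovable (?A2₁ {Γ} _ d) ns =
    negated-unprovable d (All-plug Γ (λ { (node p (node q r)) → node (node p q) r }) ns)
  negated-unprovable (?A2₂ {Γ} _ d) ns =
    negated-unprovable d (All-plug Γ (λ { (node (node p q) r) → node p (node q r) }) ns)

  bangAbove-leaf : ∀ {i F A} → QuestAboveT S i (leaf F) → Hat⊥View A F → BangAboveT S i (leaf A)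
  bangAbove-leaf (leaf le) (!ᵢ _ _) = leaf le

  bangAboveᵀ : ∀ {i} t → QuestAboveT S i (hatT⊥ t) → BangAboveT S i t
  bangAboveᵀ (leaf A)   q          = bangAbove-leaf q (hat⊥-view A)
  bangAboveᵀ (node l r) (node q p) = node (bangAboveᵀ l p) (bangAboveᵀ r q)

  bangAbove : ∀ {i} G → QuestAbove S i (hatS⊥ G) → BangAbove S i G
  bangAbove nothing  _ = tt
  bangAbove (just t) q = bangAboveᵀ t q

  -- Conservativity, rule by rule

  -- Every intuitionistic sequent whose translation is a rotation of Θ is provable.
  Conservative : Str (CFm I) → Set
  Conservative Θ = ∀ c {G A} → plug c ⟨ hat A ⟩ ≡ Θ → rest c ≡ hatS⊥ G → acLL S G A

  succedent-last : ∀ {X G B} → hatS⊥ G ≡ X → Conservative (X ⨾ ⟨ hat B ⟩) → acLL S G B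
  succedent-last {X} h ih = ih (X ⨾ˡ hole) (plug-⨾ˡ X hole _) (trans (rest-⨾ˡ X hole) (sym h))

  rotate-hatC⊥ : ∀ {d : Ctx (CFm I)} {R} → hatC⊥ R ≡ turn d →
    ∀ u → rotate d (hatS⊥ u) ≡ hatS⊥ (plug R u)
  rotate-hatC⊥ {d} {R} hR u = begin
    rotate d (hatS⊥ u)        ≡⟨ rotate-turn d _ ⟩
    plug (turn d) (hatS⊥ u)   ≡⟨ cong (λ K → plug K (hatS⊥ u)) hR ⟨
    plug (hatC⊥ R) (hatS⊥ u)  ≡⟨ hatS⊥-plug R u ⟨
    hatS⊥ (plug R u)          ∎

  succedent-inside : ∀ d {X R A} → plug d ⟨ hat A ⟩ ≡ X → hatC⊥ R ≡ turn d →
    ∀ u → Conservative (X ⨾ hatS⊥ u) → acLL S (plug R u) A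
  succedent-inside d e hR u ih =
    ih (d ⨾ʳ hatS⊥ u) (trans (plug-⨾ʳ d _ _) (cong (_⨾ hatS⊥ u) e))
      (trans (rest-⨾ʳ d (hatS⊥ u)) (rotate-hatC⊥ {d} hR u))

  drop-neg² : ∀ {X F} → Conservative (X ⨾ ⟨ neg (neg F) ⟩) → Conservative (X ⨾ ⟨ F ⟩)
  drop-neg² {X} {F} = subst (λ F′ → Conservative (X ⨾ ⟨ F′ ⟩)) (neg-involutive F)

  ex-conservative : ∀ {Γ Δ} → Conservative (Γ ⨾ Δ) → Conservative (Δ ⨾ Γ)
  ex-conservative {Γ} {Δ} ih c e r with locate c Δ Γ e
  ... | inˡ d e′ = ih (Γ ⨾ˡ d) (trans (plug-⨾ˡ Γ d _) (cong (Γ ⨾_) e′)) (trans (sym (rest-exchange d Γ)) r)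
  ... | inʳ d e′ = ih (d ⨾ʳ Δ) (trans (plug-⨾ʳ d Δ _) (cong (_⨾ Δ) e′)) (trans (rest-exchange d Δ) r)

  as₁-conservative : ∀ {Γ Δ Λ} → Conservative ((Γ ⨾ Δ) ⨾ Λ) → Conservative (Γ ⨾ (Δ ⨾ Λ))
  as₁-conservative {Γ} {Δ} {Λ} ih c e r with locate c Γ (Δ ⨾ Λ) e
  ... | inˡ d e′ = ih ((d ⨾ʳ Δ) ⨾ʳ Λ)
        (trans (plug-⨾ʳ (d ⨾ʳ Δ) Λ _) (cong (_⨾ Λ) (trans (plug-⨾ʳ d Δ _) (cong (_⨾ Δ) e′))))
        (trans (rest-assocʳ d Δ Λ) r)
  ... | inʳ d e′ with locate d Δ Λ e′
  ...   | inˡ d′ e″ = ih ((Γ ⨾ˡ d′) ⨾ʳ Λ)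
          (trans (plug-⨾ʳ (Γ ⨾ˡ d′) Λ _) (cong (_⨾ Λ) (trans (plug-⨾ˡ Γ d′ _) (cong (Γ ⨾_) e″))))
          (trans (sym (rest-assoc Γ d′ Λ)) r)
  ...   | inʳ d′ e″ = ih ((Γ ⨾ Δ) ⨾ˡ d′) (trans (plug-⨾ˡ (Γ ⨾ Δ) d′ _) (cong ((Γ ⨾ Δ) ⨾_) e″))
          (trans (sym (rest-assocˡ Γ Δ d′)) r)

  as₂-conservative : ∀ {Γ Δ Λ} → Conservative (Γ ⨾ (Δ ⨾ Λ)) → Conservative ((Γ ⨾ Δ) ⨾ Λ)
  as₂-conservative {Γ} {Δ} {Λ} ih c e r with locate c (Γ ⨾ Δ) Λ e
  ... | inʳ d e′ = ih (Γ ⨾ˡ (Δ ⨾ˡ d))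
        (trans (plug-⨾ˡ Γ (Δ ⨾ˡ d) _) (cong (Γ ⨾_) (trans (plug-⨾ˡ Δ d _) (cong (Δ ⨾_) e′))))
        (trans (rest-assocˡ Γ Δ d) r)
  ... | inˡ d e′ with locate d Γ Δ e′
  ...   | inˡ d′ e″ = ih (d′ ⨾ʳ (Δ ⨾ Λ)) (trans (plug-⨾ʳ d′ (Δ ⨾ Λ) _) (cong (_⨾ (Δ ⨾ Λ)) e″))
          (trans (sym (rest-assocʳ d′ Δ Λ)) r)
  ...   | inʳ d′ e″ = ih (Γ ⨾ˡ (d′ ⨾ʳ Λ))
          (trans (plug-⨾ˡ Γ (d′ ⨾ʳ Λ) _) (cong (Γ ⨾_) (trans (plug-⨾ʳ d′ Λ _) (cong (_⨾ Λ) e″))))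
          (trans (rest-assoc Γ d′ Λ) r)

  RightCase : Str (CFm I) → CFm I → Set
  RightCase X F = ∀ {G A} → HatView A F → hatS⊥ G ≡ X → acLL S G A

  LeftCase : Str (CFm I) → CFm I → Set
  LeftCase X F = ∀ d {G A} → plug d ⟨ hat A ⟩ ≡ X → hatS⊥ G ≡ plug (turn d) ⟨ F ⟩ → acLL S G A

  LeftLeafCase : Str (CFm I) → CFm I → Set
  LeftLeafCase X F =
    ∀ d R {Z A} → plug d ⟨ hat A ⟩ ≡ X → hatC⊥ R ≡ turn d → Hat⊥View Z F → acLL S (plug R ⟨ Z ⟩) A

  conservative-principal : ∀ {X F} → RightCase X F → LeftCase X F → Conservative (X ⨾ ⟨ F ⟩)
  conservative-principal {X} {F} right left c e r with locate c X ⟨ F ⟩ e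
  ... | inˡ d e′ = left d e′ (trans (sym r) (trans (rest-⨾ʳ d ⟨ F ⟩) (rotate-turn d ⟨ F ⟩)))
  ... | inʳ d e′ with plug-leaf⁻¹ d e′
  ...   | refl , o = right (view-hat o) (trans (sym r) (rest-⨾ˡ X hole))

  conservative-principalˡ : ∀ {X F} → RightCase X F → LeftLeafCase X F → Conservative (X ⨾ ⟨ F ⟩)
  conservative-principalˡ {X} {F} right left = conservative-principal right left′
    where
    left′ : LeftCase X F
    left′ d {G} e h with hatS⊥-plug⁻¹ (turn d) G h
    ... | R , y , refl , hR , hy with hatT⊥-leaf⁻¹ y hy
    ...   | Z , refl , v = left d R e hR v

  init-right : ∀ {F} → RightCase ⟨ neg F ⟩ F
  init-right {G = G} v h with hat-view-sound v
  ... | refl with hatS⊥-leaf⁻¹ G h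
  ...   | Z , refl , w with hat-injective (neg-injective (hat⊥-view-sound w))
  ...     | refl = init

  init-left : ∀ {F} → LeftCase ⟨ neg F ⟩ F
  init-left d {G} e h with plug-leaf⁻¹ d e
  ... | refl , o with hatS⊥-leaf⁻¹ G h
  ...   | Z , refl , w with hat⊥-view-sound w
  ...     | refl with hat-injective (trans o (neg-involutive (hat Z)))
  ...       | refl = init

  init-conservative : ∀ {F} → Conservative (⟨ neg F ⟩ ⨾ ⟨ F ⟩)
  init-conservative = conservative-principal init-right init-left

  ⊗R-right : ∀ {Γ Δ A B} → Conservative (Γ ⨾ ⟨ A ⟩) → Conservative (Δ ⨾ ⟨ B ⟩) →
    RightCase (Δ ⨾ Γ) (A ⊗ B)
  ⊗R-right {Γ} {Δ} ih₁ ih₂ {G} (_ ⊗ᵢ _) h with hatS⊥-⨾⁻¹ G Δ Γ h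
  ... | _ , _ , refl , h₂ , h₁ = ⊗R (succedent-last h₁ ih₁) (succedent-last h₂ ih₂)

  -- The succedent lies in one premise of ⊗. If the tensor does not come from the implication
  -- whose argument is the other premise, that premise consists of negated translations only.
  ⊗R-left-in-Γ : ∀ {Γ Δ A B d R Y Z A₀} → Conservative (Γ ⨾ ⟨ A ⟩) → Conservative (Δ ⨾ ⟨ B ⟩) →
    ¬ All Negated (Δ ⨾ ⟨ B ⟩) → plug d ⟨ hat A₀ ⟩ ≡ Γ → hatC⊥ R ≡ turn d → hatS⊥ Y ≡ Δ →
    Hat⊥View Z (A ⊗ B) → acLL S (plug R (Y ⨾ ⟨ Z ⟩)) A₀
  ⊗R-left-in-Γ {d = d} {R} {Y} ih₁ ih₂ _ e hR hY (_ ⊸ W) =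
    ⊸L {Γ = R} {Δ = Y} (succedent-last hY (drop-neg² ih₂)) (succedent-inside d e hR ⟨ W ⟩ ih₁)
  ⊗R-left-in-Γ {Y = Y} _ _ n₂ _ _ hY (W ⟜ _) =
    ⊥-elim (n₂ (All-⨾⁺ _ _ (subst (All Negated) hY (hatS⊥-negated Y)) (leaf (negated W))))

  ⊗R-left-in-Δ : ∀ {Γ Δ A B d R Y Z A₀} → Conservative (Γ ⨾ ⟨ A ⟩) → Conservative (Δ ⨾ ⟨ B ⟩) →
    ¬ All Negated (Γ ⨾ ⟨ A ⟩) → plug d ⟨ hat A₀ ⟩ ≡ Δ → hatC⊥ R ≡ turn d → hatS⊥ Y ≡ Γ →
    Hat⊥View Z (A ⊗ B) → acLL S (plug R (⟨ Z ⟩ ⨾ Y)) A₀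
  ⊗R-left-in-Δ {Y = Y} _ _ n₁ _ _ hY (_ ⊸ W) =
    ⊥-elim (n₁ (All-⨾⁺ _ _ (subst (All Negated) hY (hatS⊥-negated Y)) (leaf (negated W))))
  ⊗R-left-in-Δ {d = d} {R} {Y} ih₁ ih₂ _ e hR hY (W ⟜ _) =
    ⟜L {Γ = R} {Δ = Y} (succedent-last hY (drop-neg² ih₁)) (succedent-inside d e hR ⟨ W ⟩ ih₂)

  ⊗R-left : ∀ {Γ Δ A B} → Conservative (Γ ⨾ ⟨ A ⟩) → Conservative (Δ ⨾ ⟨ B ⟩) →
    ¬ All Negated (Γ ⨾ ⟨ A ⟩) → ¬ All Negated (Δ ⨾ ⟨ B ⟩) → LeftCase (Δ ⨾ Γ) (A ⊗ B)
  ⊗R-left {Γ} {Δ} ih₁ ih₂ n₁ n₂ d {G} e h with locate d Δ Γ e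
  ... | inʳ d′ e′ with hatS⊥-plug-⟨⟩⨾⁻¹ (turn d′) G Δ (trans h (turn-⨾ˡ Δ d′ _))
  ...   | _ , _ , _ , refl , hR , hY , v = ⊗R-left-in-Γ {d = d′} ih₁ ih₂ n₂ e′ hR hY v
  ⊗R-left {Γ} {Δ} ih₁ ih₂ n₁ n₂ d {G} e h | inˡ d′ e′
    with hatS⊥-plug-⨾⟨⟩⁻¹ (turn d′) G Γ (trans h (turn-⨾ʳ d′ Γ _))
  ...   | _ , _ , _ , refl , hR , hY , v = ⊗R-left-in-Δ {d = d′} ih₁ ih₂ n₁ e′ hR hY v

  ⊗R-conservative : ∀ {Γ Δ A B} → Conservative (Γ ⨾ ⟨ A ⟩) → Conservative (Δ ⨾ ⟨ B ⟩) →
    ¬ All Negated (Γ ⨾ ⟨ A ⟩) → ¬ All Negated (Δ ⨾ ⟨ B ⟩) → Conservative ((Δ ⨾ Γ) ⨾ ⟨ A ⊗ B ⟩)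
  ⊗R-conservative ih₁ ih₂ n₁ n₂ = conservative-principal (⊗R-right ih₁ ih₂) (⊗R-left ih₁ ih₂ n₁ n₂)

  ⅋R-right : ∀ {Γ A B} → Conservative (Γ ⨾ (⟨ A ⟩ ⨾ ⟨ B ⟩)) → RightCase Γ (A ⅋ B)
  ⅋R-right {Γ} ih {G} (X ⊸ Y) h =
    ⊸R (succedent-last (trans (hatS⊥-⨾ ⟨ X ⟩ G) (cong (_⨾ _) h))
      (as₂-conservative {Γ} {⟨ neg (hat X) ⟩} {⟨ hat Y ⟩} ih))
  ⅋R-right {Γ} ih {G} (Y ⟜ X) h =
    ⟜R (succedent-last (trans (hatS⊥-⨾ G ⟨ X ⟩) (cong (_ ⨾_) h))
      (as₂-conservative {⟨ neg (hat X) ⟩} {Γ} (ex-conservative {Γ ⨾ ⟨ hat Y ⟩}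
        (as₂-conservative {Γ} {⟨ hat Y ⟩} {⟨ neg (hat X) ⟩} ih))))

  ⅋R-left : ∀ {Γ A B} → Conservative (Γ ⨾ (⟨ A ⟩ ⨾ ⟨ B ⟩)) → LeftLeafCase Γ (A ⅋ B)
  ⅋R-left ih d R e hR (Z₁ ⊗ᵢ Z₂) = ⊗L {Γ = R} (succedent-inside d e hR (⟨ Z₁ ⟩ ⨾ ⟨ Z₂ ⟩) ih)

  ⅋R-conservative : ∀ {Γ A B} → Conservative (Γ ⨾ (⟨ A ⟩ ⨾ ⟨ B ⟩)) → Conservative (Γ ⨾ ⟨ A ⅋ B ⟩)
  ⅋R-conservative ih = conservative-principalˡ (⅋R-right ih) (⅋R-left ih)

  ⊕R₁-right : ∀ {Γ A B} → Conservative (Γ ⨾ ⟨ A ⟩) → RightCase Γ (A ⊕ B)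
  ⊕R₁-right ih (_ ⊕ᵢ _) h = ⊕R₁ (succedent-last h ih)

  ⊕R₁-left : ∀ {Γ A B} → Conservative (Γ ⨾ ⟨ A ⟩) → LeftLeafCase Γ (A ⊕ B)
  ⊕R₁-left ih d R e hR (Z₁ &ᵢ _) = &L₁ {Γ = R} (succedent-inside d e hR ⟨ Z₁ ⟩ ih)

  ⊕R₁-conservative : ∀ {Γ A B} → Conservative (Γ ⨾ ⟨ A ⟩) → Conservative (Γ ⨾ ⟨ A ⊕ B ⟩)
  ⊕R₁-conservative ih = conservative-principalˡ (⊕R₁-right ih) (⊕R₁-left ih)

  ⊕R₂-right : ∀ {Γ A B} → Conservative (Γ ⨾ ⟨ B ⟩) → RightCase Γ (A ⊕ B)
  ⊕R₂-right ih (_ ⊕ᵢ _) h = ⊕R₂ (succedent-last h ih)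

  ⊕R₂-left : ∀ {Γ A B} → Conservative (Γ ⨾ ⟨ B ⟩) → LeftLeafCase Γ (A ⊕ B)
  ⊕R₂-left ih d R e hR (_ &ᵢ Z₂) = &L₂ {Γ = R} (succedent-inside d e hR ⟨ Z₂ ⟩ ih)

  ⊕R₂-conservative : ∀ {Γ A B} → Conservative (Γ ⨾ ⟨ B ⟩) → Conservative (Γ ⨾ ⟨ A ⊕ B ⟩)
  ⊕R₂-conservative ih = conservative-principalˡ (⊕R₂-right ih) (⊕R₂-left ih)

  &R-right : ∀ {Γ A B} → Conservative (Γ ⨾ ⟨ A ⟩) → Conservative (Γ ⨾ ⟨ B ⟩) → RightCase Γ (A & B)
  &R-right ih₁ ih₂ (_ &ᵢ _) h = &R (succedent-last h ih₁) (succedent-last h ih₂)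

  &R-left : ∀ {Γ A B} → Conservative (Γ ⨾ ⟨ A ⟩) → Conservative (Γ ⨾ ⟨ B ⟩) → LeftLeafCase Γ (A & B)
  &R-left ih₁ ih₂ d R e hR (Z₁ ⊕ᵢ Z₂) =
    ⊕L {Γ = R} (succedent-inside d e hR ⟨ Z₁ ⟩ ih₁) (succedent-inside d e hR ⟨ Z₂ ⟩ ih₂)

  &R-conservative : ∀ {Γ A B} → Conservative (Γ ⨾ ⟨ A ⟩) → Conservative (Γ ⨾ ⟨ B ⟩) →
    Conservative (Γ ⨾ ⟨ A & B ⟩)
  &R-conservative ih₁ ih₂ = conservative-principalˡ (&R-right ih₁ ih₂) (&R-left ih₁ ih₂)

  𝟏R-right : RightCase nothing 𝟏
  𝟏R-right {G} 𝟏ᵢ h rewrite hatS⊥-nothing⁻¹ G h = 𝟏R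

  𝟏R-left : LeftLeafCase nothing 𝟏
  𝟏R-left d _ e _ _ = ⊥-elim (plug-nonempty d e)

  𝟏R-conservative : Conservative ⟨ 𝟏 ⟩
  𝟏R-conservative = conservative-principalˡ 𝟏R-right 𝟏R-left

  ⊥R-left : ∀ {Γ} → Conservative Γ → LeftLeafCase Γ ⊥ᶜ
  ⊥R-left {Γ} ih d R e hR 𝟏ᵢ =
    𝟏L {Γ = R} (succedent-inside d e hR nothing (subst Conservative (sym (⨾-identityʳ Γ)) ih))

  ⊥R-conservative : ∀ {Γ} → Conservative Γ → Conservative (Γ ⨾ ⟨ ⊥ᶜ ⟩)
  ⊥R-conservative ih = conservative-principalˡ (λ ()) (⊥R-left ih)

  ⊤R-right : ∀ {Γ} → RightCase Γ ⊤ᶜ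
  ⊤R-right ⊤ᵢ _ = ⊤R

  ⊤R-conservative : ∀ {Γ} → Conservative (Γ ⨾ ⟨ ⊤ᶜ ⟩)
  ⊤R-conservative = conservative-principalˡ ⊤R-right λ _ _ _ _ ()

  ?D-left : ∀ {Γ i A} → Conservative (Γ ⨾ ⟨ A ⟩) → LeftLeafCase Γ (⁇ i A)
  ?D-left ih d R e hR (!ᵢ _ Z) = !L {Γ = R} (succedent-inside d e hR ⟨ Z ⟩ ih)

  ?D-conservative : ∀ {Γ i A} → Conservative (Γ ⨾ ⟨ A ⟩) → Conservative (Γ ⨾ ⟨ ⁇ i A ⟩)
  ?D-conservative ih = conservative-principalˡ (λ ()) (?D-left ih)

  !P-right : ∀ {Γ i A} → QuestAbove S i Γ → Conservative (Γ ⨾ ⟨ A ⟩) → RightCase Γ (‼ i A)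
  !P-right q ih {G} (!ᵢ i _) h =
    !R (bangAbove G (subst (QuestAbove S i) (sym h) q)) (succedent-last h ih)

  !P-conservative : ∀ {Γ i A} → QuestAbove S i Γ → Conservative (Γ ⨾ ⟨ A ⟩) →
    Conservative (Γ ⨾ ⟨ ‼ i A ⟩)
  !P-conservative q ih = conservative-principalˡ (!P-right q ih) λ _ _ _ _ ()

  ApartCase : Str (CFm I) → Tree (CFm I) → Set
  ApartCase s x =
    ∀ R y {A} → hatT⊥ y ≡ x → (∀ u → hatS⊥ u ≡ s → acLL S (plug R u) A) → acLL S (plug R (just y)) A

  NestedCase : Ctx (CFm I) → Tree (CFm I) → Set
  NestedCase Γ x = ∀ d {G A} → x ≡ plugᵀ d (leaf (hat A)) → rest (Γ ∘ᶜ d) ≡ hatS⊥ G → acLL S G A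

  conservative-deep : ∀ {Γ s x} → Conservative (plug Γ s) → ApartCase s x → NestedCase Γ x →
    Conservative (plug Γ (just x))
  conservative-deep {Γ} {s} {x} ih apart-case nested-case c {G} e r
    with overlap-view Γ c (plugᵀ-≡ Γ c (sym e))
  ... | nested d q = nested-case d q r
  ... | apart K h with hatS⊥-plug⁻¹ (turn₂ K nothing) G (trans (sym r) (rotate-fill₁ K nothing _))
  ...   | R , y , refl , hR , hy = apart-case R y hy λ u hu → ih (fill₁ K s) (sym (h s)) (begin
          rest (fill₁ K s)          ≡⟨ rotate-fill₁ K nothing s ⟩
          plug (turn₂ K nothing) s  ≡⟨ cong₂ plug hR hu ⟨
          plug (hatC⊥ R) (hatS⊥ u)  ≡⟨ hatS⊥-plug R u ⟨
          hatS⊥ (plug R u)          ∎)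

  ⁇-nested : ∀ {Γ i A} → NestedCase Γ (leaf (⁇ i A))
  ⁇-nested d {A = A₀} q _ = ⊥-elim (hat≢⁇ A₀ (proj₂ (plugᵀ-leaf⁻¹ d (sym q))))

  ?W-apart : ∀ {i A} → f i sW ≡ true → ApartCase nothing (leaf (⁇ i A))
  ?W-apart p R y hy premise with hatT⊥-leaf⁻¹ y hy
  ... | _ , refl , !ᵢ _ _ = !W {Γ = R} p (premise nothing refl)

  ?C-apart : ∀ {i A} → f i sC ≡ true → ApartCase (⟨ ⁇ i A ⟩ ⨾ ⟨ ⁇ i A ⟩) (leaf (⁇ i A))
  ?C-apart p R y hy premise with hatT⊥-leaf⁻¹ y hy
  ... | Z , refl , !ᵢ _ _ = !C {Γ = R} p (premise (⟨ Z ⟩ ⨾ ⟨ Z ⟩) refl)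

  ?E₁-apart : ∀ {Δ i A} → f i sE ≡ true → ApartCase (just Δ ⨾ ⟨ ⁇ i A ⟩) (node (leaf (⁇ i A)) Δ)
  ?E₁-apart p R (node l r) hy premise with node-injective hy
  ... | hr , hl with hatT⊥-leaf⁻¹ r hr
  ...   | Z , refl , !ᵢ _ _ =
    !E₂ {Γ = R} {Δ = l} p (premise (⟨ Z ⟩ ⨾ just l) (cong (λ t → just (node t (leaf _))) hl))

  ?E₂-apart : ∀ {Δ i A} → f i sE ≡ true → ApartCase (⟨ ⁇ i A ⟩ ⨾ just Δ) (node Δ (leaf (⁇ i A)))
  ?E₂-apart p R (node l r) hy premise with node-injective hy
  ... | hr , hl with hatT⊥-leaf⁻¹ l hl
  ...   | Z , refl , !ᵢ _ _ =
    !E₁ {Γ = R} {Δ = r} p (premise (just r ⨾ ⟨ Z ⟩) (cong (λ t → just (node (leaf _) t)) hr))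

  !E₁′ : ∀ {R i A C} → f i sE ≡ true → ∀ Y →
    acLL S (plug R (Y ⨾ ⟨ !ᵢ i A ⟩)) C → acLL S (plug R (⟨ !ᵢ i A ⟩ ⨾ Y)) C
  !E₁′ p nothing  d = d
  !E₁′ {R} p (just t) d = !E₁ {Γ = R} {Δ = t} p d

  !E₂′ : ∀ {R i A C} → f i sE ≡ true → ∀ Y →
    acLL S (plug R (⟨ !ᵢ i A ⟩ ⨾ Y)) C → acLL S (plug R (Y ⨾ ⟨ !ᵢ i A ⟩)) C
  !E₂′ p nothing  d = d
  !E₂′ {R} p (just t) d = !E₂ {Γ = R} {Δ = t} p d

  -- The succedent lies inside Δ: after rotation, exchanging ⁇ with Δ is exchanging it with
  -- the rest of the antecedent, which the exchange rule for ! performs.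
  ?E₁-nested : ∀ {Γ Δ i A} → f i sE ≡ true → Conservative (plug Γ (just Δ ⨾ ⟨ ⁇ i A ⟩)) →
    NestedCase Γ (node (leaf (⁇ i A)) Δ)
  ?E₁-nested p ih (inL d _) {A = A₀} q _ =
    ⊥-elim (hat≢⁇ A₀ (proj₂ (plugᵀ-leaf⁻¹ d (sym (proj₁ (node-injective q))))))
  ?E₁-nested {Γ} {i = i} {A} p ih (inR _ d) {G} {A₀} q r with node-injective q
  ... | refl , refl with hatS⊥-plug-⨾⟨⟩⁻¹ (turn d) G (rest Γ)
                          (trans (sym r) (trans (rotate-∘ᶜ Γ _ nothing) (rotate-turn d _)))
  ...   | R , Y , Z , refl , hR , hY , !ᵢ _ _ = !E₁′ {R} p Y (ih (Γ ∘ᶜ inL d (leaf (⁇ i A)))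
          (trans (plug-∘ᶜ Γ _ _) (cong (λ z → plug Γ (z ⨾ ⟨ ⁇ i A ⟩)) (plug-just d (leaf (hat A₀)))))
          (begin
            rest (Γ ∘ᶜ inL d (leaf (⁇ i A)))         ≡⟨ rotate-∘ᶜ Γ _ nothing ⟩
            rotate d (just (leaf (⁇ i A)) ⨾ rest Γ)  ≡⟨ cong (λ z → rotate d (just (leaf (⁇ i A)) ⨾ z)) hY ⟨
            rotate d (just (leaf (⁇ i A)) ⨾ hatS⊥ Y) ≡⟨ cong (rotate d) (hatS⊥-⨾ Y (just (leaf Z))) ⟨
            rotate d (hatS⊥ (Y ⨾ just (leaf Z)))     ≡⟨ rotate-hatC⊥ {d} hR (Y ⨾ just (leaf Z)) ⟩
            hatS⊥ (plug R (Y ⨾ just (leaf Z)))       ∎))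

  ?E₂-nested : ∀ {Γ Δ i A} → f i sE ≡ true → Conservative (plug Γ (⟨ ⁇ i A ⟩ ⨾ just Δ)) →
    NestedCase Γ (node Δ (leaf (⁇ i A)))
  ?E₂-nested p ih (inR _ d) {A = A₀} q _ =
    ⊥-elim (hat≢⁇ A₀ (proj₂ (plugᵀ-leaf⁻¹ d (sym (proj₂ (node-injective q))))))
  ?E₂-nested {Γ} {i = i} {A} p ih (inL d _) {G} {A₀} q r with node-injective q
  ... | refl , refl with hatS⊥-plug-⟨⟩⨾⁻¹ (turn d) G (rest Γ)
                          (trans (sym r) (trans (rotate-∘ᶜ Γ _ nothing) (rotate-turn d _)))
  ...   | R , Y , Z , refl , hR , hY , !ᵢ _ _ = !E₂′ {R} p Y (ih (Γ ∘ᶜ inR (leaf (⁇ i A)) d)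
          (trans (plug-∘ᶜ Γ _ _) (cong (λ z → plug Γ (⟨ ⁇ i A ⟩ ⨾ z)) (plug-just d (leaf (hat A₀)))))
          (begin
            rest (Γ ∘ᶜ inR (leaf (⁇ i A)) d)         ≡⟨ rotate-∘ᶜ Γ _ nothing ⟩
            rotate d (rest Γ ⨾ just (leaf (⁇ i A)))  ≡⟨ cong (λ z → rotate d (z ⨾ just (leaf (⁇ i A)))) hY ⟨
            rotate d (hatS⊥ Y ⨾ just (leaf (⁇ i A))) ≡⟨ cong (rotate d) (hatS⊥-⨾ (just (leaf Z)) Y) ⟨
            rotate d (hatS⊥ (just (leaf Z) ⨾ Y))     ≡⟨ rotate-hatC⊥ {d} hR (just (leaf Z) ⨾ Y) ⟩
            hatS⊥ (plug R (just (leaf Z) ⨾ Y))       ∎))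

  ?W-conservative : ∀ {Γ i A} → f i sW ≡ true → Conservative (plug Γ nothing) →
    Conservative (plug Γ ⟨ ⁇ i A ⟩)
  ?W-conservative {Γ} p ih = conservative-deep {Γ} ih (?W-apart p) (⁇-nested {Γ})

  ?C-conservative : ∀ {Γ i A} → f i sC ≡ true → Conservative (plug Γ (⟨ ⁇ i A ⟩ ⨾ ⟨ ⁇ i A ⟩)) →
    Conservative (plug Γ ⟨ ⁇ i A ⟩)
  ?C-conservative {Γ} p ih = conservative-deep {Γ} ih (?C-apart p) (⁇-nested {Γ})

  ?E₁-conservative : ∀ {Γ Δ i A} → f i sE ≡ true → Conservative (plug Γ (just Δ ⨾ ⟨ ⁇ i A ⟩)) →
    Conservative (plug Γ (⟨ ⁇ i A ⟩ ⨾ just Δ))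
  ?E₁-conservative {Γ} {Δ} p ih = conservative-deep {Γ} ih (?E₁-apart {Δ} p) (?E₁-nested {Γ} {Δ} p ih)

  ?E₂-conservative : ∀ {Γ Δ i A} → f i sE ≡ true → Conservative (plug Γ (⟨ ⁇ i A ⟩ ⨾ just Δ)) →
    Conservative (plug Γ (just Δ ⨾ ⟨ ⁇ i A ⟩))
  ?E₂-conservative {Γ} {Δ} p ih = conservative-deep {Γ} ih (?E₂-apart {Δ} p) (?E₂-nested {Γ} {Δ} p ih)

  module _ (only-CWE : OnlyCWE S) where

    no-associativity : ∀ {i} → f i sA1 ≡ true ⊎ f i sA2 ≡ true → ⊥
    no-associativity {i} (inj₁ p) with trans (sym p) (proj₁ (only-CWE i))
    ... | ()
    no-associativity {i} (inj₂ p) with trans (sym p) (proj₂ (only-CWE i))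
    ... | ()

    conservative : ∀ {Θ} → CacLL S Θ → Conservative Θ
    conservative init                = init-conservative
    conservative (ex {Γ} {Δ} d)      = ex-conservative {Γ} {Δ} (conservative d)
    conservative (as₁ {Γ} {Δ} {Λ} d) = as₁-conservative {Γ} {Δ} {Λ} (conservative d)
    conservative (as₂ {Γ} {Δ} {Λ} d) = as₂-conservative {Γ} {Δ} {Λ} (conservative d)
    conservative (⊗R d₁ d₂)          = ⊗R-conservative (conservative d₁) (conservative d₂)
                                         (negated-unprovable d₁) (negated-unprovable d₂)
    conservative (⅋R d)              = ⅋R-conservative (conservative d)
    conservative (⊕R₁ d)             = ⊕R₁-conservative (conservative d)
    conservative (⊕R₂ d)             = ⊕R₂-conservative (conservative d)
    conservative (&R d₁ d₂)          = &R-conservative (conservative d₁) (conservative d₂)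
    conservative 𝟏R                  = 𝟏R-conservative
    conservative (⊥R d)              = ⊥R-conservative (conservative d)
    conservative ⊤R                  = ⊤R-conservative
    conservative (?D d)              = ?D-conservative (conservative d)
    conservative (!P q d)            = !P-conservative q (conservative d)
    conservative (?W {Γ} p d)        = ?W-conservative {Γ} p (conservative d)
    conservative (?C {Γ} p d)        = ?C-conservative {Γ} p (conservative d)
    conservative (?E₁ {Γ} p d)       = ?E₁-conservative {Γ} p (conservative d)
    conservative (?E₂ {Γ} p d)       = ?E₂-conservative {Γ} p (conservative d)
    conservative (?A1₁ p _)          = ⊥-elim (no-associativity (inj₁ p))
    conservative (?A1₂ p _)          = ⊥-elim (no-associativity (inj₁ p))
    conservative (?A2₁ p _)          = ⊥-elim (no-associativity (inj₂ p))
    conservative (?A2₂ p _)          = ⊥-elim (no-associativity (inj₂ p))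

lemma3p5 : (S : Sig) → OnlyCWE S
    → (Γ : Str (IFm (Sig.I S))) (A : IFm (Sig.I S))
    → CacLL S (hatS⊥ Γ ⨾ just (leaf (hat A)))
    → acLL S Γ A
lemma3p5 S only-CWE Γ A d = succedent-last S refl (conservative S only-CWE d)
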